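{- Let $n\in\mathbb{N}^*$, let $\mathcal{A}_1,\ldots,\mathcal{A}_n$ be non-empty algebras in $\mathcal{C}$, and let $\mathcal{A}=\prod_{i=1}^n\mathcal{A}_i$. Then: (1) ${\rm Max}(\mathcal{A})=\bigcup_{i=1}^n\{\nabla_{\mathcal{A}_1}\times\ldots\times\nabla_{\mathcal{A}_{i-1}}\times\theta\times\nabla_{\mathcal{A}_{i+1}}\times\ldots\times\nabla_{\mathcal{A}_n}\mid\theta\in{\rm Max}(\mathcal{A}_i)\}$; consequently $|{\rm Max}(\mathcal{A})|=\sum_{i=1}^n|{\rm Max}(\mathcal{A}_i)|$ and ${\rm Rad}(\mathcal{A})={\rm Rad}(\mathcal{A}_1)\times\ldots\times{\rm Rad}(\mathcal{A}_n)$; (2) ${\rm Spec}(\mathcal{A})=\bigcup_{i=1}^n\{\nabla_{\mathcal{A}_1}\times\ldots\times\nabla_{\mathcal{A}_{i-1}}\times\theta\times\nabla_{\mathcal{A}_{i+1}}\times\ldots\times\nabla_{\mathcal{A}_n}\mid\theta\in{\rm Spec}(\mathcal{A}_i)\}$; consequently $|{\rm Spec}(\mathcal{A})|=\sum_{i=1}^n|{\rm Spec}(\mathcal{A}_i)|$.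
   Context: $\mathcal{C}$ is an equational class of congruence-distributive algebras of some signature, such that every non-empty algebra $\mathcal{A}$ in $\mathcal{C}$ satisfies (H): $\nabla_{\mathcal{A}}=A^2$ is compact in the congruence lattice ${\rm Con}(\mathcal{A})$. Direct products carry componentwise operations. For congruences $\theta_i$ of $\mathcal{A}_i$ (support $A_i$), $\theta_1\times\ldots\times\theta_n=\{((x_1,\ldots,x_n),(y_1,\ldots,y_n))\mid(x_i,y_i)\in\theta_i\ \forall i\}$, a congruence of $\mathcal{A}$. ${\rm Max}(\cdot)$ is the set of maximal proper congruences, ${\rm Rad}(\cdot)$ their intersection; ${\rm Spec}(\cdot)$ is the set of prime congruences (proper $\phi$ such that $\theta_1\cap\theta_2\subseteq\phi$ implies $\theta_1\subseteq\phi$ or $\theta_2\subseteq\phi$). -}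

module Defs where

open import Level using (Level; 0ℓ) renaming (suc to lsuc)
open import Data.Nat using (ℕ)
open import Data.Fin using (Fin; _≟_)
open import Data.Bool using (Bool; true; false)
open import Data.List using (List)
open import Data.List.Membership.Propositional using (_∈_)
open import Data.Product using (Σ; _×_; _,_; proj₁; proj₂)
open import Data.Sum using (_⊎_)
open import Data.Unit.Polymorphic using (⊤)
open import Relation.Nullary using (¬_; yes; no)
open import Relation.Binary using (Rel; IsEquivalence; Setoid)
open import Relation.Binary.PropositionalEquality using (_≡_; refl)

record Signature : Set₁ where
  field
    Op    : Set
    arity : Op → ℕ
open Signature public

record Algebra (σ : Signature) : Set₁ where
  field
    Carrier       : Set
    _≈_           : Rel Carrier 0ℓ
    isEquivalence : IsEquivalence _≈_
    op            : (f : Op σ) → (Fin (arity σ f) → Carrier) → Carrier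
    op-cong       : ∀ f {xs ys : Fin (arity σ f) → Carrier} →
                    (∀ k → xs k ≈ ys k) → op f xs ≈ op f ys
open Algebra public

module _ {σ : Signature} where

  data Term : Set where
    var  : ℕ → Term
    node : (f : Op σ) → (Fin (arity σ f) → Term) → Term

  eval : (A : Algebra σ) → (ℕ → Carrier A) → Term → Carrier A
  eval A ρ (var v)     = ρ v
  eval A ρ (node f ts) = op A f (λ k → eval A ρ (ts k))

module _ (σ : Signature) where

  record Identities : Set₁ where
    field
      Index : Set
      lhs   : Index → Term {σ}
      rhs   : Index → Term {σ}
  open Identities public

_⊆_ : ∀ {a ℓ₁ ℓ₂} {X : Set a} → Rel X ℓ₁ → Rel X ℓ₂ → Set _
θ ⊆ ψ = ∀ {x y} → θ x y → ψ x y

_≐_ : ∀ {a ℓ₁ ℓ₂} {X : Set a} → Rel X ℓ₁ → Rel X ℓ₂ → Set _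
θ ≐ ψ = (θ ⊆ ψ) × (ψ ⊆ θ)

_∩_ : ∀ {a ℓ₁ ℓ₂} {X : Set a} → Rel X ℓ₁ → Rel X ℓ₂ → Rel X _
(θ ∩ ψ) x y = θ x y × ψ x y


module _ {σ : Signature} where

  Models : Identities σ → Algebra σ → Set
  Models E A = ∀ (e : Index E) (ρ : ℕ → Carrier A) →
               _≈_ A (eval A ρ (lhs E e)) (eval A ρ (rhs E e))

  ∇ : ∀ {ℓ} (A : Algebra σ) → Rel (Carrier A) ℓ
  ∇ A _ _ = ⊤

  record IsCongruence (A : Algebra σ) (θ : Rel (Carrier A) 0ℓ) : Set where
    field
      isEquivalence : IsEquivalence θ
      ≈⊆θ           : _≈_ A ⊆ θ
      compatible    : ∀ f {xs ys : Fin (arity σ f) → Carrier A} →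
                      (∀ k → θ (xs k) (ys k)) → θ (op A f xs) (op A f ys)

  Con : Algebra σ → Set₁
  Con A = Σ (Rel (Carrier A) 0ℓ) (IsCongruence A)

  data Join {ℓ} (A : Algebra σ) {J : Set ℓ} (θ : J → Rel (Carrier A) 0ℓ) :
            Rel (Carrier A) ℓ where
    base   : ∀ j {x y} → θ j x y → Join A θ x y
    ≈-in   : ∀ {x y} → _≈_ A x y → Join A θ x y
    sym    : ∀ {x y} → Join A θ x y → Join A θ y x
    trans  : ∀ {x y z} → Join A θ x y → Join A θ y z → Join A θ x z
    compat : ∀ f {xs ys : Fin (arity σ f) → Carrier A} →
             (∀ k → Join A θ (xs k) (ys k)) →
             Join A θ (op A f xs) (op A f ys)

  Join₂ : (A : Algebra σ) → Rel (Carrier A) 0ℓ → Rel (Carrier A) 0ℓ →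
          Rel (Carrier A) 0ℓ
  Join₂ A θ ψ = Join A {J = Bool} (λ { true → θ ; false → ψ })

  CongruenceDistributive : Algebra σ → Set₁
  CongruenceDistributive A = ∀ (α β γ : Con A) →
    (proj₁ α ∩ Join₂ A (proj₁ β) (proj₁ γ))
      ≐ Join₂ A (proj₁ α ∩ proj₁ β) (proj₁ α ∩ proj₁ γ)

  -- (H): ∇_A is a compact element of Con(A): whenever ∇_A ≤ ⋁ S for a
  -- set S of congruences (given as a family indexed by J : Set₁, which
  -- covers every subset of Con(A)), then ∇_A ≤ ⋁ S₀ for a finite S₀ ⊆ S.
  NablaCompact : Algebra σ → Set₂
  NablaCompact A = ∀ (J : Set₁) (θ : J → Con A) →
    ∇ {0ℓ} A ⊆ Join A (λ j → proj₁ (θ j)) →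
    Σ (List J) λ js →
      ∇ {0ℓ} A ⊆ Join A {J = Σ J (λ j → j ∈ js)} (λ p → proj₁ (θ (proj₁ p)))

  Proper : (A : Algebra σ) → Rel (Carrier A) 0ℓ → Set
  Proper A θ = ¬ (∇ {0ℓ} A ⊆ θ)

  IsMax : (A : Algebra σ) → Rel (Carrier A) 0ℓ → Set₁
  IsMax A θ = IsCongruence A θ × Proper A θ ×
    (∀ ψ → IsCongruence A ψ → Proper A ψ → θ ⊆ ψ → ψ ⊆ θ)

  Rad : (A : Algebra σ) → Rel (Carrier A) (lsuc 0ℓ)
  Rad A x y = ∀ θ → IsMax A θ → θ x y

  IsPrime : (A : Algebra σ) → Rel (Carrier A) 0ℓ → Set₁
  IsPrime A φ = IsCongruence A φ × Proper A φ ×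
    (∀ θ₁ θ₂ → IsCongruence A θ₁ → IsCongruence A θ₂ →
       (θ₁ ∩ θ₂) ⊆ φ → (θ₁ ⊆ φ) ⊎ (θ₂ ⊆ φ))

  SubCon : (A : Algebra σ) → (Rel (Carrier A) 0ℓ → Set₁) → Setoid (lsuc 0ℓ) 0ℓ
  SubCon A P = record
    { Carrier = Σ (Rel (Carrier A) 0ℓ) P
    ; _≈_ = λ a b → proj₁ a ≐ proj₁ b
    ; isEquivalence = record
      { refl  = (λ p → p) , (λ p → p)
      ; sym   = λ { (f , g) → g , f }
      ; trans = λ { (f , g) (h , k) → (λ p → h (f p)) , (λ p → g (k p)) } } }

  MaxSetoid : Algebra σ → Setoid (lsuc 0ℓ) 0ℓ
  MaxSetoid A = SubCon A (IsMax A)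

  SpecSetoid : Algebra σ → Setoid (lsuc 0ℓ) 0ℓ
  SpecSetoid A = SubCon A (IsPrime A)

  Π : ∀ {n} → (Fin n → Algebra σ) → Algebra σ
  Π {n} As = record
    { Carrier = (i : Fin n) → Carrier (As i)
    ; _≈_ = λ x y → ∀ i → _≈_ (As i) (x i) (y i)
    ; isEquivalence = record
      { refl  = λ i → IsEquivalence.refl (isEquivalence (As i))
      ; sym   = λ p i → IsEquivalence.sym (isEquivalence (As i)) (p i)
      ; trans = λ p q i → IsEquivalence.trans (isEquivalence (As i)) (p i) (q i) }
    ; op = λ f xs i → op (As i) f (λ k → xs k i)
    ; op-cong = λ f p i → op-cong (As i) f (λ k → p k i) }

  ProdRel : ∀ {n ℓ} {As : Fin n → Algebra σ} →
            ((i : Fin n) → Rel (Carrier (As i)) ℓ) → Rel (Carrier (Π As)) ℓ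
  ProdRel θs x y = ∀ i → θs i (x i) (y i)

  slot : ∀ {n ℓ} (As : Fin n → Algebra σ) (i : Fin n) →
         Rel (Carrier (As i)) ℓ → (j : Fin n) → Rel (Carrier (As j)) ℓ
  slot As i θ j with j ≟ i
  ... | yes refl = θ
  ... | no _     = ∇ (As j)

  Embed : ∀ {n} (As : Fin n → Algebra σ) (i : Fin n) →
          Rel (Carrier (As i)) 0ℓ → Rel (Carrier (Π As)) 0ℓ
  Embed As i θ = ProdRel {As = As} (slot As i θ)

-- disjoint union of a finite family of setoids (for cardinal sums)

module _ {n : ℕ} (S : Fin n → Setoid (lsuc 0ℓ) 0ℓ) where

  data _≈⊔_ : Rel (Σ (Fin n) (λ i → Setoid.Carrier (S i))) (lsuc 0ℓ) where
    same : ∀ {i a b} → Setoid._≈_ (S i) a b → (i , a) ≈⊔ (i , b)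

  ⊔Setoid : Setoid (lsuc 0ℓ) (lsuc 0ℓ)
  ⊔Setoid = record
    { Carrier = Σ (Fin n) (λ i → Setoid.Carrier (S i))
    ; _≈_ = _≈⊔_
    ; isEquivalence = record
      { refl  = λ { {i , a} → same (Setoid.refl (S i)) }
      ; sym   = λ { (same {i} p) → same (Setoid.sym (S i) p) }
      ; trans = λ { (same {i} p) (same q) → same (Setoid.trans (S i) p q) } } }

Rel′ : ∀ {σ n} (As : Fin n → Algebra σ) (i : Fin n) → Set₁
Rel′ As i = Rel (Carrier (As i)) 0ℓ

module Submission where

-- The heart of the proof is the decomposition theorem: in a
-- congruence-distributive product every congruence ψ is a product
-- congruence ψ₁ × … × ψₙ.  Indeed the kernels κᵢ of the projections meet
-- in the identity, so distributivity gives ψ = ψ ∨ ⋂ᵢ κᵢ = ⋂ᵢ (ψ ∨ κᵢ),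
-- and ψ ∨ κᵢ only depends on the i-th coordinates.  From it:
--   * a proper product congruence has a proper factor (classically), so a
--     maximal congruence is ∇ × … × θ × … × ∇ with θ maximal;
--   * a prime φ = ⋂ᵢ (∇ × … × φᵢ × … × ∇) contains one of these finitely
--     many congruences, so it equals it, and φᵢ is prime;
--   * conversely, embedded maximal / prime congruences are maximal / prime.
-- Non-emptiness lets us pass between Aᵢ and Π A by updating one coordinate
-- of a fixed point.  The cardinality statements are setoid bijections
-- ⊔ᵢ Max(Aᵢ) ≅ Max(Π A) and ⊔ᵢ Spec(Aᵢ) ≅ Spec(Π A), and the formula for
-- the radical follows from the description of Max(Π A).

open import Defs
open import Level using (0ℓ; lift; lower) renaming (suc to lsuc)
open import Data.Nat using (ℕ; _≤_)
import Data.Nat as ℕ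
open import Data.Fin using (Fin; zero; suc; _≟_)
open import Data.Fin.Properties using (¬∀⟶∃¬)
open import Data.Bool using (true; false)
open import Data.Product using (Σ; _×_; _,_; proj₁; proj₂; swap)
open import Data.Unit.Polymorphic using (tt)
open import Data.Empty using (⊥-elim)
open import Data.Sum using (_⊎_; inj₁; inj₂)
import Data.Sum as Sum
open import Relation.Nullary using (Dec; yes; no)
open import Relation.Nullary.Decidable using (map′)
open import Relation.Binary using (Rel; IsEquivalence; Setoid)
open import Relation.Binary.PropositionalEquality
  using (_≡_; refl; _≢_; subst; subst₂) renaming (sym to ≡-sym)
open import Axiom.ExcludedMiddle using (ExcludedMiddle)
open import Function.Bundles using (Bijection)

module CongruenceLaws {σ : Signature} {A : Algebra σ} {θ : Rel (Carrier A) 0ℓ}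
                      (c : IsCongruence A θ) where
  open IsEquivalence (IsCongruence.isEquivalence c) public
    using () renaming (refl to θ-refl; sym to θ-sym; trans to θ-trans)

module Lattice {σ : Signature} (A : Algebra σ) where

  join-least : ∀ {J : Set} {θ : J → Rel (Carrier A) 0ℓ} {χ : Rel (Carrier A) 0ℓ} →
               IsCongruence A χ → (∀ j → θ j ⊆ χ) → Join A θ ⊆ χ
  join-least c h (base j p)    = h j p
  join-least c h (≈-in p)      = IsCongruence.≈⊆θ c p
  join-least c h (sym p)       = CongruenceLaws.θ-sym c (join-least c h p)
  join-least c h (trans p q)   = CongruenceLaws.θ-trans c (join-least c h p) (join-least c h q)
  join-least c h (compat f ps) = IsCongruence.compatible c f (λ k → join-least c h (ps k))

  join-isCongruence : ∀ {J : Set} {θ : J → Rel (Carrier A) 0ℓ} → IsCongruence A (Join A θ)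
  join-isCongruence = record
    { isEquivalence = record
      { refl = ≈-in (IsEquivalence.refl (isEquivalence A)) ; sym = sym ; trans = trans }
    ; ≈⊆θ = ≈-in ; compatible = compat }

  join₂-isCongruence : ∀ {θ ψ : Rel (Carrier A) 0ℓ} → IsCongruence A (Join₂ A θ ψ)
  join₂-isCongruence = join-isCongruence

  join₂-mono : ∀ {θ θ′ ψ ψ′ : Rel (Carrier A) 0ℓ} →
               θ ⊆ θ′ → ψ ⊆ ψ′ → Join₂ A θ ψ ⊆ Join₂ A θ′ ψ′
  join₂-mono f g = join-least join-isCongruence
    λ { true p → base true (f p) ; false p → base false (g p) }

  ∩-isCongruence : ∀ {α β : Rel (Carrier A) 0ℓ} →
                   IsCongruence A α → IsCongruence A β → IsCongruence A (α ∩ β)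
  ∩-isCongruence cα cβ = record
    { isEquivalence = record
      { refl  = α.θ-refl , β.θ-refl
      ; sym   = λ { (p , q) → α.θ-sym p , β.θ-sym q }
      ; trans = λ { (p , q) (r , s) → α.θ-trans p r , β.θ-trans q s } }
    ; ≈⊆θ = λ p → IsCongruence.≈⊆θ cα p , IsCongruence.≈⊆θ cβ p
    ; compatible = λ f ps → IsCongruence.compatible cα f (λ k → proj₁ (ps k))
                          , IsCongruence.compatible cβ f (λ k → proj₂ (ps k)) }
    where module α = CongruenceLaws cα
          module β = CongruenceLaws cβ

  ⋂ : ∀ {m} → (Fin m → Rel (Carrier A) 0ℓ) → Rel (Carrier A) 0ℓ
  ⋂ α x y = ∀ k → α k x y

  ⋂-isCongruence : ∀ {m} {α : Fin m → Rel (Carrier A) 0ℓ} →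
                   (∀ k → IsCongruence A (α k)) → IsCongruence A (⋂ α)
  ⋂-isCongruence c = record
    { isEquivalence = record
      { refl  = λ k → CongruenceLaws.θ-refl (c k)
      ; sym   = λ p k → CongruenceLaws.θ-sym (c k) (p k)
      ; trans = λ p q k → CongruenceLaws.θ-trans (c k) (p k) (q k) }
    ; ≈⊆θ = λ p k → IsCongruence.≈⊆θ (c k) p
    ; compatible = λ f ps k → IsCongruence.compatible (c k) f (λ j → ps j k) }

  ⋂-cons : ∀ {m} {α : Fin (ℕ.suc m) → Rel (Carrier A) 0ℓ} →
           (α zero ∩ ⋂ (λ k → α (suc k))) ⊆ ⋂ α
  ⋂-cons (p , q) zero    = p
  ⋂-cons (p , q) (suc k) = q k

module Distributivity {σ : Signature} (A : Algebra σ) (cd : CongruenceDistributive A) where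
  open Lattice A

  -- (ψ ∨ α) ∩ (ψ ∨ β) ⊆ ψ ∨ (α ∩ β): expand the left side by distributivity
  -- over ψ ∨ β; the part (ψ ∨ α) ∩ β = (β ∩ ψ) ∨ (β ∩ α) lies in ψ ∨ (α ∩ β).
  ∨-∩-distrib : ∀ {ψ α β : Rel (Carrier A) 0ℓ} →
                IsCongruence A ψ → IsCongruence A α → IsCongruence A β →
                (Join₂ A ψ α ∩ Join₂ A ψ β) ⊆ Join₂ A ψ (α ∩ β)
  ∨-∩-distrib {ψ} {α} {β} cψ cα cβ p =
    join-least join-isCongruence
      (λ { true  (_ , q) → base true q
         ; false (r , q) → β∩[ψ∨α]⊆ψ∨[α∩β] (q , r) })
      (proj₁ (cd (Join₂ A ψ α , join-isCongruence) (ψ , cψ) (β , cβ)) p)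
    where
      β∩[ψ∨α]⊆ψ∨[α∩β] : (β ∩ Join₂ A ψ α) ⊆ Join₂ A ψ (α ∩ β)
      β∩[ψ∨α]⊆ψ∨[α∩β] q = join₂-mono proj₂ swap (proj₁ (cd (β , cβ) (ψ , cψ) (α , cα)) q)

  ∨-⋂-distrib : ∀ {ψ : Rel (Carrier A) 0ℓ} → IsCongruence A ψ →
                ∀ m (α : Fin m → Rel (Carrier A) 0ℓ) → (∀ k → IsCongruence A (α k)) →
                ⋂ (λ k → Join₂ A ψ (α k)) ⊆ Join₂ A ψ (⋂ α)
  ∨-⋂-distrib cψ ℕ.zero    α cα h = base false (λ ())
  ∨-⋂-distrib cψ (ℕ.suc m) α cα h =
    join₂-mono (λ p → p) (⋂-cons {α = α})
      (∨-∩-distrib cψ (cα zero) (⋂-isCongruence (λ k → cα (suc k)))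
        (h zero , ∨-⋂-distrib cψ m (λ k → α (suc k)) (λ k → cα (suc k)) (λ k → h (suc k))))

module PrimeAvoidance {σ : Signature} (A : Algebra σ) where
  open Lattice A

  prime-avoidance : ∀ {φ} → IsPrime A φ →
                    ∀ m (β : Fin m → Rel (Carrier A) 0ℓ) → (∀ k → IsCongruence A (β k)) →
                    ⋂ β ⊆ φ → Σ (Fin m) λ k → β k ⊆ φ
  prime-avoidance (_ , properφ , _) ℕ.zero β cβ ⋂β⊆φ = ⊥-elim (properφ (λ _ → ⋂β⊆φ (λ ())))
  prime-avoidance pφ@(_ , _ , primeφ) (ℕ.suc m) β cβ ⋂β⊆φ
    with primeφ (β zero) (⋂ (λ k → β (suc k))) (cβ zero) (⋂-isCongruence (λ k → cβ (suc k)))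
                (λ p → ⋂β⊆φ (⋂-cons {α = β} p))
  ... | inj₁ β₀⊆φ = zero , β₀⊆φ
  ... | inj₂ rest⊆φ with prime-avoidance pφ m (λ k → β (suc k)) (λ k → cβ (suc k)) rest⊆φ
  ...   | k , βₖ⊆φ = suc k , βₖ⊆φ

module Products {σ : Signature} {n : ℕ} (As : Fin n → Algebra σ) where

  update : Carrier (Π As) → (i : Fin n) → Carrier (As i) → Carrier (Π As)
  update x i a j with j ≟ i
  ... | yes refl = a
  ... | no _     = x j

  update-here : ∀ x i a → update x i a i ≡ a
  update-here x i a with i ≟ i
  ... | yes refl = refl
  ... | no i≢i   = ⊥-elim (i≢i refl)

  update-there : ∀ x {i j} a → j ≢ i → update x i a j ≡ x j
  update-there x {i} {j} a j≢i with j ≟ i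
  ... | yes j≡i = ⊥-elim (j≢i j≡i)
  ... | no _    = refl

  ker : (i : Fin n) → Rel (Carrier (Π As)) 0ℓ
  ker i x y = _≈_ (As i) (x i) (y i)

  ker-isCongruence : ∀ i → IsCongruence (Π As) (ker i)
  ker-isCongruence i = record
    { isEquivalence = record { refl = ≈ᵢ.refl ; sym = ≈ᵢ.sym ; trans = ≈ᵢ.trans }
    ; ≈⊆θ = λ p → p i ; compatible = λ f ps → op-cong (As i) f ps }
    where module ≈ᵢ = IsEquivalence (isEquivalence (As i))

  ker-update : ∀ i {x y a b} → _≈_ (As i) a b → ker i (update x i a) (update y i b)
  ker-update i {x} {y} {a} {b} =
    subst₂ (_≈_ (As i)) (≡-sym (update-here x i a)) (≡-sym (update-here y i b))

  ker-restore : ∀ i x y → ker i x (update y i (x i))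
  ker-restore i x y = IsEquivalence.reflexive (isEquivalence (As i)) (≡-sym (update-here y i (x i)))

  prod-isCongruence : ∀ {θs : ∀ i → Rel′ As i} →
                      (∀ i → IsCongruence (As i) (θs i)) → IsCongruence (Π As) (ProdRel {As = As} θs)
  prod-isCongruence c = record
    { isEquivalence = record
      { refl  = λ i → CongruenceLaws.θ-refl (c i)
      ; sym   = λ p i → CongruenceLaws.θ-sym (c i) (p i)
      ; trans = λ p q i → CongruenceLaws.θ-trans (c i) (p i) (q i) }
    ; ≈⊆θ = λ p i → IsCongruence.≈⊆θ (c i) (p i)
    ; compatible = λ f ps i → IsCongruence.compatible (c i) f (λ k → ps k i) }

  prod-update : ∀ {θs : ∀ i → Rel′ As i} → (∀ i → IsCongruence (As i) (θs i)) →
                ∀ {i x a b} → θs i a b → ProdRel {As = As} θs (update x i a) (update x i b)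
  prod-update c {i} p k with k ≟ i
  ... | yes refl = p
  ... | no _     = CongruenceLaws.θ-refl (c k)

  slot-here : ∀ {i} (θ : Rel′ As i) → slot As i θ i ≡ θ
  slot-here {i} θ with i ≟ i
  ... | yes refl = refl
  ... | no i≢i   = ⊥-elim (i≢i refl)

  slot-isCongruence : ∀ {i} {θ : Rel′ As i} → IsCongruence (As i) θ →
                      ∀ j → IsCongruence (As j) (slot As i θ j)
  slot-isCongruence {i} c j with j ≟ i
  ... | yes refl = c
  ... | no _     = record
    { isEquivalence = record { refl = tt ; sym = λ _ → tt ; trans = λ _ _ → tt }
    ; ≈⊆θ = λ _ → tt ; compatible = λ _ _ → tt }

  slot-mono : ∀ {i} {θ θ′ : Rel′ As i} → θ ⊆ θ′ →
              ∀ j {a b} → slot As i θ j a b → slot As i θ′ j a b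
  slot-mono {i} f j p with j ≟ i
  ... | yes refl = f p
  ... | no _     = tt

  embed-isCongruence : ∀ {i} {θ : Rel′ As i} → IsCongruence (As i) θ →
                       IsCongruence (Π As) (Embed As i θ)
  embed-isCongruence c = prod-isCongruence (slot-isCongruence c)

  embed-mono : ∀ {i} {θ θ′ : Rel′ As i} → θ ⊆ θ′ → Embed As i θ ⊆ Embed As i θ′
  embed-mono f e j = slot-mono f j (e j)

  embed-intro : ∀ {i} {θ : Rel′ As i} {x y} → θ (x i) (y i) → Embed As i θ x y
  embed-intro {i} p j with j ≟ i
  ... | yes refl = p
  ... | no _     = tt

  embed-elim : ∀ {i} {θ : Rel′ As i} {x y} → Embed As i θ x y → θ (x i) (y i)
  embed-elim {i} {θ} {x} {y} e = subst (λ R → R (x i) (y i)) (slot-here θ) (e i)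

  embed-update : ∀ {i} {θ : Rel′ As i} {x y a b} →
                 θ a b → Embed As i θ (update x i a) (update y i b)
  embed-update {i} {θ} {x} {y} {a} {b} p =
    embed-intro (subst₂ θ (≡-sym (update-here x i a)) (≡-sym (update-here y i b)) p)

  embed-update⁻¹ : ∀ {i} {θ : Rel′ As i} {x y a b} →
                   Embed As i θ (update x i a) (update y i b) → θ a b
  embed-update⁻¹ {i} {θ} {x} {y} {a} {b} e =
    subst₂ θ (update-here x i a) (update-here y i b) (embed-elim e)

  embed-update-elsewhere : ∀ {i j} {θ : Rel′ As i} → IsCongruence (As i) θ → j ≢ i →
                           ∀ {x c d} → Embed As i θ (update x j c) (update x j d)
  embed-update-elsewhere {i} {j} {θ} cθ j≢i {x} {c} {d} =
    embed-intro (subst₂ θ (≡-sym (update-there x c i≢j)) (≡-sym (update-there x d i≢j))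
                          (CongruenceLaws.θ-refl cθ))
    where i≢j : i ≢ j
          i≢j i≡j = j≢i (≡-sym i≡j)

  prod⊆embed : ∀ {θs : ∀ i → Rel′ As i} {i} {θ : Rel′ As i} →
               θs i ⊆ θ → ProdRel {As = As} θs ⊆ Embed As i θ
  prod⊆embed f p = embed-intro (f (p _))

  embed-∩ : ∀ {i} {α β : Rel′ As i} → (Embed As i α ∩ Embed As i β) ⊆ Embed As i (α ∩ β)
  embed-∩ (e₁ , e₂) = embed-intro (embed-elim e₁ , embed-elim e₂)

  ⋂embed⊆prod : ∀ {θs : ∀ i → Rel′ As i} →
                Lattice.⋂ (Π As) (λ i → Embed As i (θs i)) ⊆ ProdRel {As = As} θs
  ⋂embed⊆prod e i = embed-elim (e i)

  module WithPoint (point : ∀ i → Carrier (As i)) where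

    embed-reflects : ∀ {i} {θ ψ : Rel′ As i} → Embed As i θ ⊆ Embed As i ψ → θ ⊆ ψ
    embed-reflects f p = embed-update⁻¹ {x = point} {y = point} (f (embed-update p))

    embed-proper : ∀ {i} {θ : Rel′ As i} → Proper (As i) θ → Proper (Π As) (Embed As i θ)
    embed-proper {i} pr total =
      pr (λ {a} {b} _ → embed-update⁻¹ (total {update point i a} {update point i b} tt))

    embed-distinct : ∀ {i j} {θ : Rel′ As i} {θ′ : Rel′ As j} → IsCongruence (As j) θ′ →
                     i ≢ j → Embed As j θ′ ⊆ Embed As i θ → ∇ {ℓ = 0ℓ} (As i) ⊆ θ
    embed-distinct cθ′ i≢j f _ = embed-update⁻¹ (f (embed-update-elsewhere cθ′ i≢j {point}))

    embed⊆prod : ∀ {i} {θ : Rel′ As i} {θs : ∀ j → Rel′ As j} →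
                 IsCongruence (As i) θ → Embed As i θ ⊆ ProdRel {As = As} θs →
                 (θ ⊆ θs i) × (∀ j → j ≢ i → ∇ {ℓ = 0ℓ} (As j) ⊆ θs j)
    embed⊆prod {i} {θ} {θs} cθ f = here , elsewhere
      where
        here : θ ⊆ θs i
        here {a} {b} p = subst₂ (θs i) (update-here point i a) (update-here point i b)
                                (f (embed-update p) i)
        elsewhere : ∀ j → j ≢ i → ∇ {ℓ = 0ℓ} (As j) ⊆ θs j
        elsewhere j j≢i {c} {d} _ =
          subst₂ (θs j) (update-here point j c) (update-here point j d)
                 (f (embed-update-elsewhere cθ j≢i {point}) j)

  prod-total : ∀ {i} {θs : ∀ j → Rel′ As j} → (∀ j → j ≢ i → ∇ {ℓ = 0ℓ} (As j) ⊆ θs j) →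
               ∇ {ℓ = 0ℓ} (As i) ⊆ θs i → ∇ {ℓ = 0ℓ} (Π As) ⊆ ProdRel {As = As} θs
  prod-total {i} elsewhere here {x} {y} _ j with j ≟ i
  ... | yes refl = here tt
  ... | no j≢i   = elsewhere j j≢i tt

module Decomposition {σ : Signature} {n : ℕ} (As : Fin n → Algebra σ)
                     (point : ∀ i → Carrier (As i))
                     (cd : CongruenceDistributive (Π As)) where
  open Products As
  open Lattice (Π As)
  open Distributivity (Π As) cd

  component : Rel (Carrier (Π As)) 0ℓ → (i : Fin n) → Rel′ As i
  component ψ i a b = Join₂ (Π As) ψ (ker i) (update point i a) (update point i b)

  -- ψ ∨ κᵢ is saturated for κᵢ, so it only depends on the i-th coordinates.
  join-ker-resp : ∀ {ψ} i {x y x′ y′} → Join₂ (Π As) ψ (ker i) x y →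
                  ker i x x′ → ker i y y′ → Join₂ (Π As) ψ (ker i) x′ y′
  join-ker-resp i p q r = trans (sym (base false q)) (trans p (base false r))

  join-ker⇔component : ∀ {ψ} i {x y} →
    (Join₂ (Π As) ψ (ker i) x y → component ψ i (x i) (y i)) ×
    (component ψ i (x i) (y i) → Join₂ (Π As) ψ (ker i) x y)
  join-ker⇔component i {x} {y} =
      (λ p → join-ker-resp i p (ker-restore i x point) (ker-restore i y point))
    , (λ p → trans (base false (ker-restore i x point))
                   (trans p (sym (base false (ker-restore i y point)))))

  component-isCongruence : ∀ ψ i → IsCongruence (As i) (component ψ i)
  component-isCongruence ψ i = record
    { isEquivalence = record { refl = J.θ-refl ; sym = J.θ-sym ; trans = J.θ-trans }
    ; ≈⊆θ = λ a≈b → base false (ker-update i a≈b)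
    ; compatible = λ f {xs} {ys} ps →
        join-ker-resp i (compat f ps) (op-update f xs) (op-update f ys) }
    where
      module J = CongruenceLaws (join₂-isCongruence {ψ} {ker i})
      module ≈ᵢ = IsEquivalence (isEquivalence (As i))
      op-update : ∀ f zs → ker i (op (Π As) f (λ k → update point i (zs k)))
                                 (update point i (op (As i) f zs))
      op-update f zs = ≈ᵢ.trans (op-cong (As i) f (λ k → ≈ᵢ.reflexive (update-here point i (zs k))))
                                (≈ᵢ.reflexive (≡-sym (update-here point i (op (As i) f zs))))

  -- ψ = ⋂ᵢ (ψ ∨ κᵢ), using ψ ∨ ⋂ᵢ κᵢ = ψ as ⋂ᵢ κᵢ is the identity.
  decomposition : ∀ {ψ} → IsCongruence (Π As) ψ → ψ ≐ ProdRel {As = As} (component ψ)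
  decomposition {ψ} cψ =
      (λ p i → proj₁ (join-ker⇔component i) (base true p))
    , (λ h → join-least cψ (λ { true p → p ; false p → IsCongruence.≈⊆θ cψ p })
               (∨-⋂-distrib cψ n ker ker-isCongruence
                 (λ i → proj₂ (join-ker⇔component i) (h i))))

-- Maximal and prime congruences of a congruence-distributive product of
-- non-empty algebras.  Excluded middle is used only in `proper-factor`.
module MaxAndSpec {σ : Signature} {n : ℕ} (As : Fin n → Algebra σ)
                  (point : ∀ i → Carrier (As i))
                  (cd : CongruenceDistributive (Π As))
                  (em : ExcludedMiddle (lsuc 0ℓ)) where
  open Products As
  open WithPoint point
  open Decomposition As point cd
  open PrimeAvoidance (Π As)

  decide : (P : Set) → Dec P
  decide P = map′ lower lift em

  proper-factor : (θs : ∀ i → Rel′ As i) → Proper (Π As) (ProdRel {As = As} θs) →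
                  Σ (Fin n) λ i → Proper (As i) (θs i)
  proper-factor θs proper =
    ¬∀⟶∃¬ n (λ i → ∇ {ℓ = 0ℓ} (As i) ⊆ θs i) (λ i → decide _)
           (λ total → proper (λ _ i → total i tt))

  -- A maximal μ equals ∇ × … × μᵢ × … × ∇ for a proper factor μᵢ of its
  -- decomposition, and μᵢ is maximal since θ ↦ ∇ × … × θ × … × ∇ is monotone
  -- and preserves and reflects properness.
  max-char : ∀ μ → IsMax (Π As) μ →
             Σ (Fin n) λ i → Σ (Rel′ As i) λ θ → IsMax (As i) θ × (μ ≐ Embed As i θ)
  max-char μ (cμ , properμ , maximalμ) =
    i , component μ i , (component-isCongruence μ i , properᵢ , maximalᵢ) , (μ⊆E , E⊆μ)
    where
      decomp : μ ≐ ProdRel {As = As} (component μ)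
      decomp = decomposition cμ
      factor : Σ (Fin n) λ i → Proper (As i) (component μ i)
      factor = proper-factor (component μ) (λ total → properμ (λ t → proj₂ decomp (total t)))
      i : Fin n
      i = proj₁ factor
      properᵢ : Proper (As i) (component μ i)
      properᵢ = proj₂ factor
      μ⊆E : μ ⊆ Embed As i (component μ i)
      μ⊆E p = embed-intro (proj₁ decomp p i)
      E⊆μ : Embed As i (component μ i) ⊆ μ
      E⊆μ = maximalμ _ (embed-isCongruence (component-isCongruence μ i))
                       (embed-proper properᵢ) μ⊆E
      maximalᵢ : ∀ ψ → IsCongruence (As i) ψ → Proper (As i) ψ →
                 component μ i ⊆ ψ → ψ ⊆ component μ i
      maximalᵢ ψ cψ properψ μᵢ⊆ψ = embed-reflects λ e →
        μ⊆E (maximalμ _ (embed-isCongruence cψ) (embed-proper properψ)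
                        (λ p → embed-mono μᵢ⊆ψ (μ⊆E p)) e)

  -- If ψ ⊇ ∇ × … × θ × … × ∇ is proper then its i-th component is a proper
  -- congruence above θ (all others are total), hence equals θ.
  max-embed : ∀ i θ → IsMax (As i) θ → IsMax (Π As) (Embed As i θ)
  max-embed i θ (cθ , properθ , maximalθ) = embed-isCongruence cθ , embed-proper properθ , maximal
    where
      maximal : ∀ ψ → IsCongruence (Π As) ψ → Proper (Π As) ψ →
                Embed As i θ ⊆ ψ → ψ ⊆ Embed As i θ
      maximal ψ cψ properψ E⊆ψ p = prod⊆embed ψᵢ⊆θ (proj₁ decomp p)
        where
          decomp : ψ ≐ ProdRel {As = As} (component ψ)
          decomp = decomposition cψ
          E⊆Πψ : (θ ⊆ component ψ i) × (∀ j → j ≢ i → ∇ {ℓ = 0ℓ} (As j) ⊆ component ψ j)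
          E⊆Πψ = embed⊆prod cθ (λ e → proj₁ decomp (E⊆ψ e))
          properᵢ : Proper (As i) (component ψ i)
          properᵢ total = properψ (λ t → proj₂ decomp (prod-total (proj₂ E⊆Πψ) total t))
          ψᵢ⊆θ : component ψ i ⊆ θ
          ψᵢ⊆θ = maximalθ _ (component-isCongruence ψ i) properᵢ (proj₁ E⊆Πψ)

  radical : Rad (Π As) ≐ ProdRel {As = As} (λ i → Rad (As i))
  radical = (λ r i θ maxθ → embed-elim (r _ (max-embed i θ maxθ))) , Πrad⊆rad
    where
      Πrad⊆rad : ProdRel {As = As} (λ i → Rad (As i)) ⊆ Rad (Π As)
      Πrad⊆rad h μ maxμ with max-char μ maxμ
      ... | i , θ , maxθ , (_ , E⊆μ) = E⊆μ (embed-intro (h i θ maxθ))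

  -- A prime φ is the meet of the ∇ × … × φᵢ × … × ∇, so by prime avoidance
  -- it contains, hence equals, one of them; φᵢ inherits primality.
  prime-char : ∀ φ → IsPrime (Π As) φ →
               Σ (Fin n) λ i → Σ (Rel′ As i) λ θ → IsPrime (As i) θ × (φ ≐ Embed As i θ)
  prime-char φ pφ@(cφ , properφ , primeφ) =
    i , component φ i , (component-isCongruence φ i , properᵢ , primeᵢ) , (φ⊆E , E⊆φ)
    where
      decomp : φ ≐ ProdRel {As = As} (component φ)
      decomp = decomposition cφ
      avoided : Σ (Fin n) λ i → Embed As i (component φ i) ⊆ φ
      avoided = prime-avoidance pφ n (λ i → Embed As i (component φ i))
                  (λ i → embed-isCongruence (component-isCongruence φ i))
                  (λ e → proj₂ decomp (⋂embed⊆prod e))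
      i : Fin n
      i = proj₁ avoided
      E⊆φ : Embed As i (component φ i) ⊆ φ
      E⊆φ = proj₂ avoided
      φ⊆E : φ ⊆ Embed As i (component φ i)
      φ⊆E p = embed-intro (proj₁ decomp p i)
      properᵢ : Proper (As i) (component φ i)
      properᵢ total = properφ (λ _ → E⊆φ (embed-intro (total tt)))
      primeᵢ : ∀ α β → IsCongruence (As i) α → IsCongruence (As i) β →
               (α ∩ β) ⊆ component φ i → (α ⊆ component φ i) ⊎ (β ⊆ component φ i)
      primeᵢ α β cα cβ α∩β⊆φᵢ =
        Sum.map (λ h → embed-reflects (λ e → φ⊆E (h e))) (λ h → embed-reflects (λ e → φ⊆E (h e)))
          (primeφ (Embed As i α) (Embed As i β) (embed-isCongruence cα) (embed-isCongruence cβ)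
                  (λ e → E⊆φ (embed-mono α∩β⊆φᵢ (embed-∩ e))))

  -- Decompose θ₁, θ₂; their i-th components meet inside θ, so one of them
  -- lies in θ, and then θ₁ (or θ₂) lies in ∇ × … × θ × … × ∇.
  prime-embed : ∀ i θ → IsPrime (As i) θ → IsPrime (Π As) (Embed As i θ)
  prime-embed i θ (cθ , properθ , primeθ) = embed-isCongruence cθ , embed-proper properθ , prime
    where
      prime : ∀ θ₁ θ₂ → IsCongruence (Π As) θ₁ → IsCongruence (Π As) θ₂ →
              (θ₁ ∩ θ₂) ⊆ Embed As i θ → (θ₁ ⊆ Embed As i θ) ⊎ (θ₂ ⊆ Embed As i θ)
      prime θ₁ θ₂ c₁ c₂ θ₁∩θ₂⊆E =
        Sum.map (via d₁) (via d₂)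
          (primeθ (component θ₁ i) (component θ₂ i)
                  (component-isCongruence θ₁ i) (component-isCongruence θ₂ i) components⊆θ)
        where
          via : ∀ {χ} → χ ≐ ProdRel {As = As} (component χ) →
                component χ i ⊆ θ → χ ⊆ Embed As i θ
          via d χᵢ⊆θ p = prod⊆embed χᵢ⊆θ (proj₁ d p)
          d₁ : θ₁ ≐ ProdRel {As = As} (component θ₁)
          d₁ = decomposition c₁
          d₂ : θ₂ ≐ ProdRel {As = As} (component θ₂)
          d₂ = decomposition c₂
          components⊆θ : (component θ₁ i ∩ component θ₂ i) ⊆ θ
          components⊆θ (p , q) = embed-update⁻¹ {x = point} {y = point}
            (θ₁∩θ₂⊆E ( proj₂ d₁ (prod-update (component-isCongruence θ₁) p)
                     , proj₂ d₂ (prod-update (component-isCongruence θ₂) q)))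

-- θ ↦ ∇ × … × θ × … × ∇ is a bijection from ⊔ᵢ {θ | Pᵢ θ} onto {μ | Q μ}
-- (congruences compared as sets) as soon as it maps each Pᵢ into Q, every
-- Q-congruence arises this way, and all Pᵢ-relations are proper congruences:
-- properness makes embeddings at different slots incomparable.
module EmbeddingBijection {σ : Signature} {n : ℕ} (As : Fin n → Algebra σ)
    (point : ∀ i → Carrier (As i))
    (P : ∀ i → Rel′ As i → Set₁) (Q : Rel (Carrier (Π As)) 0ℓ → Set₁)
    (char : ∀ μ → Q μ → Σ (Fin n) λ i → Σ (Rel′ As i) λ θ → P i θ × (μ ≐ Embed As i θ))
    (embed : ∀ i θ → P i θ → Q (Embed As i θ))
    (P-isCongruence : ∀ {i θ} → P i θ → IsCongruence (As i) θ)
    (P-proper : ∀ {i θ} → P i θ → Proper (As i) θ) where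
  open Products As
  open WithPoint point

  ⊔P : Setoid (lsuc 0ℓ) (lsuc 0ℓ)
  ⊔P = ⊔Setoid (λ i → SubCon (As i) (P i))

  ΠQ : Setoid (lsuc 0ℓ) 0ℓ
  ΠQ = SubCon (Π As) Q

  to : Setoid.Carrier ⊔P → Setoid.Carrier ΠQ
  to (i , θ , pθ) = Embed As i θ , embed i θ pθ

  to-cong : ∀ {x y} → Setoid._≈_ ⊔P x y → Setoid._≈_ ΠQ (to x) (to y)
  to-cong (same (θ⊆θ′ , θ′⊆θ)) = embed-mono θ⊆θ′ , embed-mono θ′⊆θ

  to-injective : ∀ {x y} → Setoid._≈_ ΠQ (to x) (to y) → Setoid._≈_ ⊔P x y
  to-injective {i , θ , pθ} {j , θ′ , pθ′} (E⊆E′ , E′⊆E) with i ≟ j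
  ... | yes refl = same (embed-reflects E⊆E′ , embed-reflects E′⊆E)
  ... | no i≢j   = ⊥-elim (P-proper pθ (embed-distinct (P-isCongruence pθ′) i≢j E′⊆E))

  to-surjective : ∀ y → Σ (Setoid.Carrier ⊔P) λ x →
                  ∀ {z} → Setoid._≈_ ⊔P z x → Setoid._≈_ ΠQ (to z) y
  to-surjective (μ , qμ) with char μ qμ
  ... | i , θ , pθ , (μ⊆E , E⊆μ) = (i , θ , pθ) , preimage
    where
      preimage : ∀ {z} → Setoid._≈_ ⊔P z (i , θ , pθ) → Setoid._≈_ ΠQ (to z) (μ , qμ)
      preimage (same (θ′⊆θ , θ⊆θ′)) = (λ e → E⊆μ (embed-mono θ′⊆θ e))
                                    , (λ p → embed-mono θ⊆θ′ (μ⊆E p))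

  bijection : Bijection ⊔P ΠQ
  bijection = record { to = to ; cong = to-cong ; bijective = to-injective , to-surjective }

module ProductModels {σ : Signature} {n : ℕ} (As : Fin n → Algebra σ) where

  eval-Π : ∀ ρ t i → _≈_ (As i) (eval (Π As) ρ t i) (eval (As i) (λ v → ρ v i) t)
  eval-Π ρ (var v)     i = IsEquivalence.refl (isEquivalence (As i))
  eval-Π ρ (node f ts) i = op-cong (As i) f (λ k → eval-Π ρ (ts k) i)

  Π-models : (E : Identities σ) → (∀ i → Models E (As i)) → Models E (Π As)
  Π-models E models e ρ i =
    ≈ᵢ.trans (eval-Π ρ (lhs E e) i)
      (≈ᵢ.trans (models i e (λ v → ρ v i)) (≈ᵢ.sym (eval-Π ρ (rhs E e) i)))
    where module ≈ᵢ = IsEquivalence (isEquivalence (As i))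

-- Π As lies in C, hence is congruence-distributive, and everything follows
-- from the module MaxAndSpec.
proposition3p5 :
    ExcludedMiddle (lsuc 0ℓ) →
    (σ : Signature) (E : Identities σ) →
    (∀ (A : Algebra σ) → Models E A → CongruenceDistributive A) →
    (∀ (A : Algebra σ) → Models E A → Carrier A → NablaCompact A) →
    (n : ℕ) → 1 ≤ n →
    (As : Fin n → Algebra σ) → (∀ i → Models E (As i)) →
    (∀ i → Carrier (As i)) →
    ((∀ μ → IsMax (Π As) μ →
        Σ (Fin n) λ i → Σ (Rel′ As i) λ θ → IsMax (As i) θ × (μ ≐ Embed As i θ))
     × (∀ i θ → IsMax (As i) θ → IsMax (Π As) (Embed As i θ))
     × Bijection (⊔Setoid (λ i → MaxSetoid (As i))) (MaxSetoid (Π As))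
     × (Rad (Π As) ≐ ProdRel {As = As} (λ i → Rad (As i))))
    ×
    ((∀ φ → IsPrime (Π As) φ →
        Σ (Fin n) λ i → Σ (Rel′ As i) λ θ → IsPrime (As i) θ × (φ ≐ Embed As i θ))
     × (∀ i θ → IsPrime (As i) θ → IsPrime (Π As) (Embed As i θ))
     × Bijection (⊔Setoid (λ i → SpecSetoid (As i))) (SpecSetoid (Π As)))
proposition3p5 em σ E distributive _ n _ As models point =
    (max-char , max-embed , max-bijection , radical)
  , (prime-char , prime-embed , spec-bijection)
  where
    open MaxAndSpec As point (distributive (Π As) (ProductModels.Π-models As E models)) em

    max-bijection : Bijection (⊔Setoid (λ i → MaxSetoid (As i))) (MaxSetoid (Π As))
    max-bijection = EmbeddingBijection.bijection As point (λ i → IsMax (As i)) (IsMax (Π As))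
                      max-char max-embed proj₁ (λ m → proj₁ (proj₂ m))

    spec-bijection : Bijection (⊔Setoid (λ i → SpecSetoid (As i))) (SpecSetoid (Π As))
    spec-bijection = EmbeddingBijection.bijection As point (λ i → IsPrime (As i)) (IsPrime (Π As))
                       prime-char prime-embed proj₁ (λ p → proj₁ (proj₂ p))
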